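{- Let $X=\{X_1,X_2\}$ be a $\lambda_2$-equitable $2$-partition of $J(n,3)$ and let $\{a,b,c\}$ be a vertex with $\overline{abc}=1$. Then: (1) If $\overline{ab\ast}=\overline{ac\ast}$, there are no $d,e\in[n]\setminus\{a,b,c\}$ with $\overline{abd}=\overline{abe}=1$ and $\overline{acd}=\overline{ace}=0$. (2) If $\overline{ab\ast}>\overline{ac\ast}$, there are no $d,e\in[n]\setminus\{a,b,c\}$ such that (a) $\overline{acd}=1$ and $\overline{abe}=\overline{abd}=\overline{ace}=0$; or (b) $\overline{abd}=0$ and $\overline{abe}=\overline{acd}=\overline{ace}=1$; or (c) $\overline{acd}=\overline{ace}=1$ and $\overline{abd}=\overline{abe}=0$.
   Context: $J(n,3)$: vertices are the $3$-subsets of $[n]$, adjacent iff they share exactly two elements; it is $3(n-3)$-regular. An equitable $2$-partition $\{X_1,X_2\}$ with quotient matrix $(p_{ij})$ means each vertex of $X_i$ has exactly $p_{ij}$ neighbours in $X_j$; it is $\lambda_2$-equitable if $p_{11}-p_{21}=n-7$. For a vertex $u$, $\overline{u}=1$ if $u\in X_1$ and $0$ otherwise; $\overline{xyz}=\overline{\{x,y,z\}}$. For distinct $i,j$, $\overline{ij\ast}$ is the number of $3$-subsets containing $i$ and $j$ that lie in $X_1$. -}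

module Defs where

open import Data.Nat using (ℕ; zero; suc; _≡ᵇ_)
open import Data.Bool using (Bool; true; false; _∧_; if_then_else_)
open import Data.List using (List; []; _∷_; _++_; map; filterᵇ; length)
open import Data.Fin using (Fin)
open import Data.Vec using (_∷_; []; lookup)
open import Data.Fin.Subset using (Subset; Side; inside; outside; ∣_∣; _∩_; _∪_; ⁅_⁆)
open import Data.Product using (Σ; _×_; ∃; ∃-syntax)
open import Data.Integer using (ℤ; +_; _-_)
open import Relation.Binary.PropositionalEquality using (_≡_)

allSubsets : (n : ℕ) → List (Subset n)
allSubsets zero = [] ∷ []
allSubsets (suc n) = map (outside ∷_) (allSubsets n) ++ map (inside ∷_) (allSubsets n)

_∈ᵇ_ : {n : ℕ} → Fin n → Subset n → Bool
i ∈ᵇ s with lookup s i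
... | inside = true
... | outside = false

is3 : {n : ℕ} → Subset n → Bool
is3 s = ∣ s ∣ ≡ᵇ 3

vertices : (n : ℕ) → List (Subset n)
vertices n = filterᵇ is3 (allSubsets n)

adjᵇ : {n : ℕ} → Subset n → Subset n → Bool
adjᵇ u v = ∣ u ∩ v ∣ ≡ᵇ 2

-- A 2-partition {X₁,X₂} of V(J(n,3)) is given by a colouring χ of subsets;
-- X₁ = {3-subsets u | χ u ≡ true}, X₂ = {3-subsets u | χ u ≡ false}.
-- (Values of χ on non-3-subsets are irrelevant.)
Colouring : ℕ → Set
Colouring n = Subset n → Bool

sameBool : Bool → Bool → Bool
sameBool true true = true
sameBool false false = true
sameBool _ _ = false

nbrsIn : {n : ℕ} → Colouring n → Bool → Subset n → ℕ
nbrsIn {n} χ side u = length (filterᵇ (λ v → adjᵇ u v ∧ sameBool (χ v) side) (vertices n))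

IsTwoPartition : (n : ℕ) → Colouring n → Set
IsTwoPartition n χ =
  (∃[ u ] (∣ u ∣ ≡ 3 × χ u ≡ true)) × (∃[ u ] (∣ u ∣ ≡ 3 × χ u ≡ false))

IsEquitable : (n : ℕ) → Colouring n → ℕ → ℕ → ℕ → ℕ → Set
IsEquitable n χ p₁₁ p₁₂ p₂₁ p₂₂ =
  (u : Subset n) → ∣ u ∣ ≡ 3 →
    (χ u ≡ true → nbrsIn χ true u ≡ p₁₁ × nbrsIn χ false u ≡ p₁₂) ×
    (χ u ≡ false → nbrsIn χ true u ≡ p₂₁ × nbrsIn χ false u ≡ p₂₂)

IsLambda2Equitable : (n : ℕ) → Colouring n → Set
IsLambda2Equitable n χ =
  IsTwoPartition n χ ×
  Σ ℕ λ p₁₁ → Σ ℕ λ p₁₂ → Σ ℕ λ p₂₁ → Σ ℕ λ p₂₂ →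
    IsEquitable n χ p₁₁ p₁₂ p₂₁ p₂₂ × (+ p₁₁ - + p₂₁ ≡ + n - + 7)

bar3 : {n : ℕ} → Colouring n → Fin n → Fin n → Fin n → Bool
bar3 χ x y z = χ (⁅ x ⁆ ∪ (⁅ y ⁆ ∪ ⁅ z ⁆))

bar2 : {n : ℕ} → Colouring n → Fin n → Fin n → ℕ
bar2 {n} χ i j = length (filterᵇ (λ v → (i ∈ᵇ v) ∧ ((j ∈ᵇ v) ∧ χ v)) (vertices n))

-- For a triple u = {x,y,z} let pairSum x y z = \overline{xy*} + \overline{xz*} + \overline{yz*}.
-- A 3-set of X₁ meeting u in two points contains exactly one pair of u, and u itself contains
-- three, so pairSum x y z = (number of X₁-neighbours of u) + 3·\overline{xyz}; by equitability
-- and p₁₁ − p₂₁ = n − 7 this is p₂₁ + (n − 4)·\overline{xyz}. The triples abd, abe, cde cover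
-- the same pairs as acd, ace, bde, except that ab is covered twice by the former and ac twice
-- by the latter, hence
--   (n − 4)(\overline{abd} + \overline{abe} + \overline{cde}) + 2·\overline{ac*}
--     = (n − 4)(\overline{acd} + \overline{ace} + \overline{bde}) + 2·\overline{ab*}.
-- Five distinct points force n ≥ 5, and every configuration excluded by the theorem
-- contradicts this identity.
module Submission where

open import Defs
open import Data.Bool using (Bool; true; false; _∧_; if_then_else_)
open import Data.Bool.Properties using (T-≡)
open import Data.Empty using (⊥-elim)
open import Data.Fin using (Fin; zero; suc)
open import Data.Fin.Subset using (Subset; outside; inside; ∣_∣; _∩_; _∪_; ⁅_⁆; ⊥; ⊤; _∉_)
open import Data.Fin.Subset.Properties
  using ( ∉⊥; drop-not-there; x≢y⇒x∉⁅y⁆; x∈p∪q⁻; ∣p∩q∣≤∣p∣; ∣p∩q∣≤∣q∣; ∣⁅x⁆∣≡1; ∣p∣≤n; ∣⊥∣≡0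
        ; ∩-zeroˡ; ∩-identityʳ; ∩-idem; ∪-identityˡ; ∪-identityʳ )
import Data.Integer as ℤ
import Data.Integer.Properties as ℤₚ
import Data.Integer.Tactic.RingSolver as ℤ-Solver
open import Data.List using (List; []; _∷_; _++_; map; filterᵇ; length)
open import Data.List.Properties using (map-++; map-∘; map-cong)
open import Data.Nat using (ℕ; suc; _+_; _*_; _∸_; _≤_; _<_; _>_; _≡ᵇ_; z≤n; s≤s; >-nonZero)
open import Data.Nat.ListAction using (sum)
open import Data.Nat.ListAction.Properties using (sum-++)
open import Data.Nat.Properties
open import Algebra.Properties.CommutativeSemigroup +-commutativeSemigroup
  using (interchange; x∙yz≈y∙xz)
open import Data.Nat.Tactic.RingSolver using (solve-∀)
open import Data.Product using (_×_; _,_; proj₁; proj₂; ∃-syntax)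
open import Data.Sum using (_⊎_; inj₁; inj₂; [_,_])
open import Data.Vec using (_∷_; []; lookup; here)
open import Data.Vec.Properties using (∷-injectiveʳ; lookup-replicate)
open import Function using (_∘_; Equivalence)
open import Relation.Nullary using (¬_)
open import Relation.Binary.PropositionalEquality
  using (_≡_; _≢_; refl; sym; trans; cong; cong₂; subst; ≢-sym; module ≡-Reasoning)

open ≡-Reasoning

private
  variable
    n : ℕ

⟦_⟧ : Bool → ℕ
⟦ true ⟧ = 1
⟦ false ⟧ = 0

⟦b⟧≤1+k : ∀ b k → ⟦ b ⟧ ≤ suc k
⟦b⟧≤1+k true k = s≤s z≤n
⟦b⟧≤1+k false k = z≤n

∑ : {A : Set} → (A → ℕ) → List A → ℕ
∑ f xs = sum (map f xs)

module _ {A : Set} where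

  ∑-++ : (f : A → ℕ) (xs ys : List A) → ∑ f (xs ++ ys) ≡ ∑ f xs + ∑ f ys
  ∑-++ f xs ys = trans (cong sum (map-++ f xs ys)) (sum-++ (map f xs) (map f ys))

  ∑-+ : (f g : A → ℕ) (xs : List A) → ∑ (λ x → f x + g x) xs ≡ ∑ f xs + ∑ g xs
  ∑-+ f g [] = refl
  ∑-+ f g (x ∷ xs) = trans (cong ((f x + g x) +_) (∑-+ f g xs)) (interchange (f x) (g x) (∑ f xs) (∑ g xs))

  ∑-* : (k : ℕ) (f : A → ℕ) (xs : List A) → ∑ (λ x → k * f x) xs ≡ k * ∑ f xs
  ∑-* k f [] = sym (*-zeroʳ k)
  ∑-* k f (x ∷ xs) = trans (cong (k * f x +_) (∑-* k f xs)) (sym (*-distribˡ-+ k (f x) (∑ f xs)))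

  ∑-cong : {f g : A → ℕ} → (∀ x → f x ≡ g x) → (xs : List A) → ∑ f xs ≡ ∑ g xs
  ∑-cong f≗g xs = cong sum (map-cong f≗g xs)

  ∑-zero : {f : A → ℕ} → (∀ x → f x ≡ 0) → (xs : List A) → ∑ f xs ≡ 0
  ∑-zero f≗0 [] = refl
  ∑-zero f≗0 (x ∷ xs) = cong₂ _+_ (f≗0 x) (∑-zero f≗0 xs)

  ∑-map : {B : Set} (f : B → ℕ) (g : A → B) (xs : List A) → ∑ f (map g xs) ≡ ∑ (f ∘ g) xs
  ∑-map f g xs = cong sum (sym (map-∘ xs))

  ∑-filterᵇ : (f : A → ℕ) (p : A → Bool) (xs : List A) →
    ∑ f (filterᵇ p xs) ≡ ∑ (λ x → if p x then f x else 0) xs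
  ∑-filterᵇ f p [] = refl
  ∑-filterᵇ f p (x ∷ xs) with p x
  ... | true = cong (f x +_) (∑-filterᵇ f p xs)
  ... | false = ∑-filterᵇ f p xs

  length-filterᵇ : (p : A → Bool) (xs : List A) → length (filterᵇ p xs) ≡ ∑ (⟦_⟧ ∘ p) xs
  length-filterᵇ p [] = refl
  length-filterᵇ p (x ∷ xs) with p x
  ... | true = cong suc (length-filterᵇ p xs)
  ... | false = length-filterᵇ p xs

∣s∷p∣≡⟦s⟧+∣p∣ : (s : Bool) (p : Subset n) → ∣ s ∷ p ∣ ≡ ⟦ s ⟧ + ∣ p ∣
∣s∷p∣≡⟦s⟧+∣p∣ true p = refl
∣s∷p∣≡⟦s⟧+∣p∣ false p = refl

∣⁅x⁆∪p∩q∣≡⟦q[x]⟧+∣p∩q∣ : ∀ {x : Fin n} {p : Subset n} → x ∉ p → (q : Subset n) →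
  ∣ (⁅ x ⁆ ∪ p) ∩ q ∣ ≡ ⟦ lookup q x ⟧ + ∣ p ∩ q ∣
∣⁅x⁆∪p∩q∣≡⟦q[x]⟧+∣p∩q∣ {x = zero} {inside ∷ p} x∉p q = ⊥-elim (x∉p here)
∣⁅x⁆∪p∩q∣≡⟦q[x]⟧+∣p∩q∣ {x = zero} {outside ∷ p} x∉p (b ∷ q) rewrite ∪-identityˡ p =
  ∣s∷p∣≡⟦s⟧+∣p∣ b (p ∩ q)
∣⁅x⁆∪p∩q∣≡⟦q[x]⟧+∣p∩q∣ {x = suc x} {s ∷ p} x∉p (b ∷ q) = begin
  ∣ (s ∧ b) ∷ ((⁅ x ⁆ ∪ p) ∩ q) ∣
    ≡⟨ ∣s∷p∣≡⟦s⟧+∣p∣ (s ∧ b) ((⁅ x ⁆ ∪ p) ∩ q) ⟩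
  ⟦ s ∧ b ⟧ + ∣ (⁅ x ⁆ ∪ p) ∩ q ∣
    ≡⟨ cong (⟦ s ∧ b ⟧ +_) (∣⁅x⁆∪p∩q∣≡⟦q[x]⟧+∣p∩q∣ (drop-not-there x∉p) q) ⟩
  ⟦ s ∧ b ⟧ + (⟦ lookup q x ⟧ + ∣ p ∩ q ∣)
    ≡⟨ x∙yz≈y∙xz ⟦ s ∧ b ⟧ ⟦ lookup q x ⟧ ∣ p ∩ q ∣ ⟩
  ⟦ lookup q x ⟧ + (⟦ s ∧ b ⟧ + ∣ p ∩ q ∣)
    ≡⟨ cong (⟦ lookup q x ⟧ +_) (∣s∷p∣≡⟦s⟧+∣p∣ (s ∧ b) (p ∩ q)) ⟨
  ⟦ lookup q x ⟧ + ∣ (s ∷ p) ∩ (b ∷ q) ∣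
    ∎

∣⁅x⁆∩q∣≡⟦q[x]⟧ : (x : Fin n) (q : Subset n) → ∣ ⁅ x ⁆ ∩ q ∣ ≡ ⟦ lookup q x ⟧
∣⁅x⁆∩q∣≡⟦q[x]⟧ {n} x q = begin
  ∣ ⁅ x ⁆ ∩ q ∣                 ≡⟨ cong (λ p → ∣ p ∩ q ∣) (∪-identityʳ ⁅ x ⁆) ⟨
  ∣ (⁅ x ⁆ ∪ ⊥) ∩ q ∣           ≡⟨ ∣⁅x⁆∪p∩q∣≡⟦q[x]⟧+∣p∩q∣ ∉⊥ q ⟩
  ⟦ lookup q x ⟧ + ∣ ⊥ ∩ q ∣    ≡⟨ cong (λ p → ⟦ lookup q x ⟧ + ∣ p ∣) (∩-zeroˡ q) ⟩
  ⟦ lookup q x ⟧ + ∣ ⊥ {n} ∣    ≡⟨ cong (⟦ lookup q x ⟧ +_) (∣⊥∣≡0 n) ⟩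
  ⟦ lookup q x ⟧ + 0            ≡⟨ +-identityʳ _ ⟩
  ⟦ lookup q x ⟧                ∎

∣⁅x⁆∪p∣≡1+∣p∣ : {x : Fin n} {p : Subset n} → x ∉ p → ∣ ⁅ x ⁆ ∪ p ∣ ≡ suc ∣ p ∣
∣⁅x⁆∪p∣≡1+∣p∣ {x = x} {p} x∉p = begin
  ∣ ⁅ x ⁆ ∪ p ∣                  ≡⟨ cong ∣_∣ (∩-identityʳ (⁅ x ⁆ ∪ p)) ⟨
  ∣ (⁅ x ⁆ ∪ p) ∩ ⊤ ∣            ≡⟨ ∣⁅x⁆∪p∩q∣≡⟦q[x]⟧+∣p∩q∣ x∉p ⊤ ⟩
  ⟦ lookup ⊤ x ⟧ + ∣ p ∩ ⊤ ∣      ≡⟨ cong₂ (λ s q → ⟦ s ⟧ + ∣ q ∣) (lookup-replicate x inside) (∩-identityʳ p) ⟩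
  suc ∣ p ∣                      ∎

x∉⁅y⁆∪p : {x y : Fin n} {p : Subset n} → x ≢ y → x ∉ p → x ∉ ⁅ y ⁆ ∪ p
x∉⁅y⁆∪p {y = y} {p} x≢y x∉p x∈ = [ x≢y⇒x∉⁅y⁆ x≢y , x∉p ] (x∈p∪q⁻ ⁅ y ⁆ p x∈)

∈ᵇ≡lookup : (x : Fin n) (p : Subset n) → x ∈ᵇ p ≡ lookup p x
∈ᵇ≡lookup x p with lookup p x
... | true = refl
... | false = refl

triple : Fin n → Fin n → Fin n → Subset n
triple x y z = ⁅ x ⁆ ∪ (⁅ y ⁆ ∪ ⁅ z ⁆)

module _ {x y z : Fin n} (x≢y : x ≢ y) (x≢z : x ≢ z) (y≢z : y ≢ z) where

  private
    x∉⁅y,z⁆ : x ∉ ⁅ y ⁆ ∪ ⁅ z ⁆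
    x∉⁅y,z⁆ = x∉⁅y⁆∪p x≢y (x≢y⇒x∉⁅y⁆ x≢z)

  ∣triple∩q∣ : (q : Subset n) →
    ∣ triple x y z ∩ q ∣ ≡ ⟦ x ∈ᵇ q ⟧ + (⟦ y ∈ᵇ q ⟧ + ⟦ z ∈ᵇ q ⟧)
  ∣triple∩q∣ q = begin
    ∣ triple x y z ∩ q ∣
      ≡⟨ ∣⁅x⁆∪p∩q∣≡⟦q[x]⟧+∣p∩q∣ x∉⁅y,z⁆ q ⟩
    ⟦ lookup q x ⟧ + ∣ (⁅ y ⁆ ∪ ⁅ z ⁆) ∩ q ∣
      ≡⟨ cong (⟦ lookup q x ⟧ +_) (∣⁅x⁆∪p∩q∣≡⟦q[x]⟧+∣p∩q∣ (x≢y⇒x∉⁅y⁆ y≢z) q) ⟩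
    ⟦ lookup q x ⟧ + (⟦ lookup q y ⟧ + ∣ ⁅ z ⁆ ∩ q ∣)
      ≡⟨ cong (λ k → ⟦ lookup q x ⟧ + (⟦ lookup q y ⟧ + k)) (∣⁅x⁆∩q∣≡⟦q[x]⟧ z q) ⟩
    ⟦ lookup q x ⟧ + (⟦ lookup q y ⟧ + ⟦ lookup q z ⟧)
      ≡⟨ cong₂ (λ s t → ⟦ s ⟧ + t) (∈ᵇ≡lookup x q)
           (cong₂ (λ s t → ⟦ s ⟧ + ⟦ t ⟧) (∈ᵇ≡lookup y q) (∈ᵇ≡lookup z q)) ⟨
    ⟦ x ∈ᵇ q ⟧ + (⟦ y ∈ᵇ q ⟧ + ⟦ z ∈ᵇ q ⟧)
      ∎

  ∣triple∣≡3 : ∣ triple x y z ∣ ≡ 3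
  ∣triple∣≡3 = trans (∣⁅x⁆∪p∣≡1+∣p∣ x∉⁅y,z⁆)
    (cong suc (trans (∣⁅x⁆∪p∣≡1+∣p∣ (x≢y⇒x∉⁅y⁆ y≢z)) (cong suc (∣⁅x⁆∣≡1 z))))

distinct₅⇒4<n : {a b c d e : Fin n} → a ≢ b → a ≢ c → b ≢ c →
  d ≢ a → d ≢ b → d ≢ c → e ≢ a → e ≢ b → e ≢ c → d ≢ e → 4 < n
distinct₅⇒4<n {a = a} {b} {c} {d} {e} a≢b a≢c b≢c d≢a d≢b d≢c e≢a e≢b e≢c d≢e =
  subst (_≤ _) ∣abcde∣≡5 (∣p∣≤n (⁅ a ⁆ ∪ (⁅ b ⁆ ∪ (⁅ c ⁆ ∪ (⁅ d ⁆ ∪ ⁅ e ⁆)))))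
  where
  ∣abcde∣≡5 : ∣ ⁅ a ⁆ ∪ (⁅ b ⁆ ∪ (⁅ c ⁆ ∪ (⁅ d ⁆ ∪ ⁅ e ⁆))) ∣ ≡ 5
  ∣abcde∣≡5 = begin
    ∣ ⁅ a ⁆ ∪ (⁅ b ⁆ ∪ (⁅ c ⁆ ∪ (⁅ d ⁆ ∪ ⁅ e ⁆))) ∣
      ≡⟨ ∣⁅x⁆∪p∣≡1+∣p∣ (x∉⁅y⁆∪p a≢b (x∉⁅y⁆∪p a≢c (x∉⁅y⁆∪p (≢-sym d≢a) (x≢y⇒x∉⁅y⁆ (≢-sym e≢a))))) ⟩
    1 + ∣ ⁅ b ⁆ ∪ (⁅ c ⁆ ∪ (⁅ d ⁆ ∪ ⁅ e ⁆)) ∣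
      ≡⟨ cong suc (∣⁅x⁆∪p∣≡1+∣p∣ (x∉⁅y⁆∪p b≢c (x∉⁅y⁆∪p (≢-sym d≢b) (x≢y⇒x∉⁅y⁆ (≢-sym e≢b))))) ⟩
    2 + ∣ ⁅ c ⁆ ∪ (⁅ d ⁆ ∪ ⁅ e ⁆) ∣
      ≡⟨ cong (2 +_) (∣⁅x⁆∪p∣≡1+∣p∣ (x∉⁅y⁆∪p (≢-sym d≢c) (x≢y⇒x∉⁅y⁆ (≢-sym e≢c)))) ⟩
    3 + ∣ ⁅ d ⁆ ∪ ⁅ e ⁆ ∣
      ≡⟨ cong (3 +_) (∣⁅x⁆∪p∣≡1+∣p∣ (x≢y⇒x∉⁅y⁆ d≢e)) ⟩
    4 + ∣ ⁅ e ⁆ ∣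
      ≡⟨ cong (4 +_) (∣⁅x⁆∣≡1 e) ⟩
    5 ∎

∣p∩q∣≡∣p∣⇒∣q∣≡∣p∣⇒q≡p : (p q : Subset n) → ∣ p ∩ q ∣ ≡ ∣ p ∣ → ∣ q ∣ ≡ ∣ p ∣ → q ≡ p
∣p∩q∣≡∣p∣⇒∣q∣≡∣p∣⇒q≡p [] [] _ _ = refl
∣p∩q∣≡∣p∣⇒∣q∣≡∣p∣⇒q≡p (inside ∷ p) (inside ∷ q) e f =
  cong (inside ∷_) (∣p∩q∣≡∣p∣⇒∣q∣≡∣p∣⇒q≡p p q (suc-injective e) (suc-injective f))
∣p∩q∣≡∣p∣⇒∣q∣≡∣p∣⇒q≡p (outside ∷ p) (outside ∷ q) e f =
  cong (outside ∷_) (∣p∩q∣≡∣p∣⇒∣q∣≡∣p∣⇒q≡p p q e f)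
∣p∩q∣≡∣p∣⇒∣q∣≡∣p∣⇒q≡p (inside ∷ p) (outside ∷ q) e _ =
  ⊥-elim (≤⇒≯ (∣p∩q∣≤∣p∣ p q) (≤-reflexive (sym e)))
∣p∩q∣≡∣p∣⇒∣q∣≡∣p∣⇒q≡p (outside ∷ p) (inside ∷ q) e f =
  ⊥-elim (≤⇒≯ (∣p∩q∣≤∣q∣ p q) (≤-reflexive (trans f (sym e))))

∑-allSubsets-suc : (f : Subset (suc n) → ℕ) →
  ∑ f (allSubsets (suc n)) ≡ ∑ (f ∘ (outside ∷_)) (allSubsets n) + ∑ (f ∘ (inside ∷_)) (allSubsets n)
∑-allSubsets-suc {n} f = trans (∑-++ f (map (outside ∷_) (allSubsets n)) (map (inside ∷_) (allSubsets n)))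
  (cong₂ _+_ (∑-map f (outside ∷_) (allSubsets n)) (∑-map f (inside ∷_) (allSubsets n)))

∑-allSubsets-single : (u : Subset n) (f : Subset n → ℕ) → (∀ v → v ≢ u → f v ≡ 0) →
  ∑ f (allSubsets n) ≡ f u
∑-allSubsets-single [] f _ = +-identityʳ (f [])
∑-allSubsets-single {suc n} (outside ∷ u) f f≡0 = begin
  ∑ f (allSubsets (suc n))
    ≡⟨ ∑-allSubsets-suc f ⟩
  ∑ (f ∘ (outside ∷_)) (allSubsets n) + ∑ (f ∘ (inside ∷_)) (allSubsets n)
    ≡⟨ cong₂ _+_
      (∑-allSubsets-single u (f ∘ (outside ∷_)) (λ v v≢u → f≡0 _ (v≢u ∘ ∷-injectiveʳ)))
      (∑-zero (λ v → f≡0 _ (λ ())) (allSubsets n)) ⟩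
  f (outside ∷ u) + 0
    ≡⟨ +-identityʳ _ ⟩
  f (outside ∷ u) ∎
∑-allSubsets-single {suc n} (inside ∷ u) f f≡0 = begin
  ∑ f (allSubsets (suc n))
    ≡⟨ ∑-allSubsets-suc f ⟩
  ∑ (f ∘ (outside ∷_)) (allSubsets n) + ∑ (f ∘ (inside ∷_)) (allSubsets n)
    ≡⟨ cong₂ _+_
      (∑-zero (λ v → f≡0 _ (λ ())) (allSubsets n))
      (∑-allSubsets-single u (f ∘ (inside ∷_)) (λ v v≢u → f≡0 _ (v≢u ∘ ∷-injectiveʳ))) ⟩
  0 + f (inside ∷ u) ∎

is3⇒∣v∣≡3 : {v : Subset n} → is3 v ≡ true → ∣ v ∣ ≡ 3
is3⇒∣v∣≡3 is3v = ≡ᵇ⇒≡ _ 3 (Equivalence.from T-≡ is3v)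

∑-vertices-single : {u : Subset n} → ∣ u ∣ ≡ 3 → (f : Subset n → ℕ) →
  (∀ v → ∣ v ∣ ≡ 3 → v ≢ u → f v ≡ 0) → ∑ f (vertices n) ≡ f u
∑-vertices-single {n} {u} ∣u∣≡3 f f≡0 = begin
  ∑ f (vertices n)               ≡⟨ ∑-filterᵇ f is3 (allSubsets n) ⟩
  ∑ f-on-vertices (allSubsets n) ≡⟨ ∑-allSubsets-single u f-on-vertices vanishes ⟩
  f-on-vertices u                ≡⟨ cong (λ b → if b then f u else 0) (Equivalence.to T-≡ (≡⇒≡ᵇ _ 3 ∣u∣≡3)) ⟩
  f u                            ∎
  where
  f-on-vertices : Subset n → ℕ
  f-on-vertices v = if is3 v then f v else 0
  vanishes : ∀ v → v ≢ u → f-on-vertices v ≡ 0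
  vanishes v v≢u with is3 v in is3v
  ... | true = f≡0 v (is3⇒∣v∣≡3 {v = v} is3v) v≢u
  ... | false = refl

∑-vertices-∣u∩v∣≡3 : {u : Subset n} → ∣ u ∣ ≡ 3 → (χ : Colouring n) →
  ∑ (λ v → ⟦ (∣ u ∩ v ∣ ≡ᵇ 3) ∧ χ v ⟧) (vertices n) ≡ ⟦ χ u ⟧
∑-vertices-∣u∩v∣≡3 {u = u} ∣u∣≡3 χ = trans (∑-vertices-single ∣u∣≡3 _ vanishes)
  (cong (λ k → ⟦ (k ≡ᵇ 3) ∧ χ u ⟧) (trans (cong ∣_∣ (∩-idem u)) ∣u∣≡3))
  where
  vanishes : ∀ v → ∣ v ∣ ≡ 3 → v ≢ u → ⟦ (∣ u ∩ v ∣ ≡ᵇ 3) ∧ χ v ⟧ ≡ 0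
  vanishes v ∣v∣≡3 v≢u with ∣ u ∩ v ∣ ≡ᵇ 3 in ∣u∩v∣≡ᵇ3
  ... | true = ⊥-elim (v≢u (∣p∩q∣≡∣p∣⇒∣q∣≡∣p∣⇒q≡p u v
                  (trans (≡ᵇ⇒≡ _ 3 (Equivalence.from T-≡ ∣u∩v∣≡ᵇ3)) (sym ∣u∣≡3)) (trans ∣v∣≡3 (sym ∣u∣≡3))))
  ... | false = refl

pairs-count : ∀ p q r c →
  ⟦ p ∧ (q ∧ c) ⟧ + ⟦ p ∧ (r ∧ c) ⟧ + ⟦ q ∧ (r ∧ c) ⟧ ≡
  ⟦ ((⟦ p ⟧ + (⟦ q ⟧ + ⟦ r ⟧)) ≡ᵇ 2) ∧ sameBool c true ⟧ + 3 * ⟦ ((⟦ p ⟧ + (⟦ q ⟧ + ⟦ r ⟧)) ≡ᵇ 3) ∧ c ⟧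
pairs-count true  true  true  true  = refl
pairs-count true  true  true  false = refl
pairs-count true  true  false true  = refl
pairs-count true  true  false false = refl
pairs-count true  false true  true  = refl
pairs-count true  false true  false = refl
pairs-count true  false false true  = refl
pairs-count true  false false false = refl
pairs-count false true  true  true  = refl
pairs-count false true  true  false = refl
pairs-count false true  false true  = refl
pairs-count false true  false false = refl
pairs-count false false true  true  = refl
pairs-count false false true  false = refl
pairs-count false false false true  = refl
pairs-count false false false false = refl

pairSum : Colouring n → Fin n → Fin n → Fin n → ℕ
pairSum χ x y z = bar2 χ x y + bar2 χ x z + bar2 χ y z

pairSum≡nbrs₁+3⟦xyz⟧ : (χ : Colouring n) {x y z : Fin n} → x ≢ y → x ≢ z → y ≢ z →
  pairSum χ x y z ≡ nbrsIn χ true (triple x y z) + 3 * ⟦ bar3 χ x y z ⟧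
pairSum≡nbrs₁+3⟦xyz⟧ {n} χ {x} {y} {z} x≢y x≢z y≢z = begin
  pairSum χ x y z
    ≡⟨ cong₂ _+_ (cong₂ _+_ (length-filterᵇ _ V) (length-filterᵇ _ V)) (length-filterᵇ _ V) ⟩
  ∑ (both x y) V + ∑ (both x z) V + ∑ (both y z) V
    ≡⟨ cong (_+ ∑ (both y z) V) (∑-+ (both x y) (both x z) V) ⟨
  ∑ (λ v → both x y v + both x z v) V + ∑ (both y z) V
    ≡⟨ ∑-+ (λ v → both x y v + both x z v) (both y z) V ⟨
  ∑ (λ v → both x y v + both x z v + both y z v) V
    ≡⟨ ∑-cong pointwise V ⟩
  ∑ (λ v → adjacent v + 3 * equal v) V
    ≡⟨ ∑-+ adjacent (λ v → 3 * equal v) V ⟩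
  ∑ adjacent V + ∑ (λ v → 3 * equal v) V
    ≡⟨ cong₂ _+_ (sym (length-filterᵇ _ V))
                 (trans (∑-* 3 equal V) (cong (3 *_) (∑-vertices-∣u∩v∣≡3 (∣triple∣≡3 x≢y x≢z y≢z) χ))) ⟩
  nbrsIn χ true u + 3 * ⟦ χ u ⟧
    ∎
  where
  V : List (Subset n)
  V = vertices n
  u : Subset n
  u = triple x y z
  both : Fin n → Fin n → Subset n → ℕ
  both i j v = ⟦ (i ∈ᵇ v) ∧ ((j ∈ᵇ v) ∧ χ v) ⟧
  adjacent equal : Subset n → ℕ
  adjacent v = ⟦ adjᵇ u v ∧ sameBool (χ v) true ⟧
  equal v = ⟦ (∣ u ∩ v ∣ ≡ᵇ 3) ∧ χ v ⟧
  pointwise : ∀ v → both x y v + both x z v + both y z v ≡ adjacent v + 3 * equal v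
  pointwise v = trans (pairs-count (x ∈ᵇ v) (y ∈ᵇ v) (z ∈ᵇ v) (χ v))
    (cong (λ k → ⟦ (k ≡ᵇ 2) ∧ sameBool (χ v) true ⟧ + 3 * ⟦ (k ≡ᵇ 3) ∧ χ v ⟧)
          (sym (∣triple∩q∣ x≢y x≢z y≢z v)))

nbrs₁+3⟦χu⟧≡p₂₁+m⟦χu⟧ : {χ : Colouring n} {p₁₁ p₁₂ p₂₁ p₂₂ m : ℕ} →
  IsEquitable n χ p₁₁ p₁₂ p₂₁ p₂₂ → p₁₁ + 3 ≡ p₂₁ + m → {u : Subset n} → ∣ u ∣ ≡ 3 →
  nbrsIn χ true u + 3 * ⟦ χ u ⟧ ≡ p₂₁ + m * ⟦ χ u ⟧
nbrs₁+3⟦χu⟧≡p₂₁+m⟦χu⟧ {χ = χ} {p₁₁} {p₂₁ = p₂₁} {m = m} equitable p₁₁+3≡p₂₁+m {u} ∣u∣≡3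
  with χ u in χu
... | true = begin
  nbrsIn χ true u + 3 ≡⟨ cong (_+ 3) (proj₁ (proj₁ (equitable u ∣u∣≡3) χu)) ⟩
  p₁₁ + 3             ≡⟨ p₁₁+3≡p₂₁+m ⟩
  p₂₁ + m             ≡⟨ cong (p₂₁ +_) (*-identityʳ m) ⟨
  p₂₁ + m * 1         ∎
... | false = begin
  nbrsIn χ true u + 0 ≡⟨ +-identityʳ _ ⟩
  nbrsIn χ true u     ≡⟨ proj₁ (proj₂ (equitable u ∣u∣≡3) χu) ⟩
  p₂₁                 ≡⟨ +-identityʳ p₂₁ ⟨
  p₂₁ + 0             ≡⟨ cong (p₂₁ +_) (*-zeroʳ m) ⟨
  p₂₁ + m * 0         ∎

pairSum-equitable : (χ : Colouring n) {p₁₁ p₁₂ p₂₁ p₂₂ m : ℕ} →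
  IsEquitable n χ p₁₁ p₁₂ p₂₁ p₂₂ → p₁₁ + 3 ≡ p₂₁ + m → {x y z : Fin n} → x ≢ y → x ≢ z → y ≢ z →
  pairSum χ x y z ≡ p₂₁ + m * ⟦ bar3 χ x y z ⟧
pairSum-equitable χ equitable p₁₁+3≡p₂₁+m x≢y x≢z y≢z =
  trans (pairSum≡nbrs₁+3⟦xyz⟧ χ x≢y x≢z y≢z)
        (nbrs₁+3⟦χu⟧≡p₂₁+m⟦χu⟧ equitable p₁₁+3≡p₂₁+m (∣triple∣≡3 x≢y x≢z y≢z))

λ₂⇒p₁₁+3≡p₂₁+[n∸4] : {p₁₁ p₂₁ : ℕ} → ℤ.+ p₁₁ ℤ.- ℤ.+ p₂₁ ≡ ℤ.+ n ℤ.- ℤ.+ 7 → 4 ≤ n →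
  p₁₁ + 3 ≡ p₂₁ + (n ∸ 4)
λ₂⇒p₁₁+3≡p₂₁+[n∸4] {n} {p} {q} λ₂ 4≤n = ℤₚ.+-injective (begin
  + (p + 3)
    ≡⟨ ℤₚ.pos-+ p 3 ⟩
  + p ℤ.+ + 3
    ≡⟨ shift (+ p) (+ q) ⟩
  (+ p ℤ.- + q) ℤ.+ (+ q ℤ.+ + 3)
    ≡⟨ cong (ℤ._+ (+ q ℤ.+ + 3)) λ₂ ⟩
  (+ n ℤ.- + 7) ℤ.+ (+ q ℤ.+ + 3)
    ≡⟨ cong (λ k → (+ k ℤ.- + 7) ℤ.+ (+ q ℤ.+ + 3)) (m+[n∸m]≡n 4≤n) ⟨
  (+ (4 + m) ℤ.- + 7) ℤ.+ (+ q ℤ.+ + 3)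
    ≡⟨ cong (λ k → (k ℤ.- + 7) ℤ.+ (+ q ℤ.+ + 3)) (ℤₚ.pos-+ 4 m) ⟩
  ((+ 4 ℤ.+ + m) ℤ.- + 7) ℤ.+ (+ q ℤ.+ + 3)
    ≡⟨ unshift (+ q) (+ m) ⟩
  + q ℤ.+ + m
    ≡⟨ ℤₚ.pos-+ q m ⟨
  + (q + m)
    ∎)
  where
  open ℤ using (+_)
  m : ℕ
  m = n ∸ 4
  shift : ∀ P Q → P ℤ.+ + 3 ≡ (P ℤ.- Q) ℤ.+ (Q ℤ.+ + 3)
  shift = ℤ-Solver.solve-∀
  unshift : ∀ Q M → ((+ 4 ℤ.+ M) ℤ.- + 7) ℤ.+ (Q ℤ.+ + 3) ≡ Q ℤ.+ M
  unshift = ℤ-Solver.solve-∀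

#true₃ : Bool → Bool → Bool → ℕ
#true₃ x y z = ⟦ x ⟧ + ⟦ y ⟧ + ⟦ z ⟧

exchange : (χ : Colouring n) {q m : ℕ} →
  (∀ {x y z} → x ≢ y → x ≢ z → y ≢ z → pairSum χ x y z ≡ q + m * ⟦ bar3 χ x y z ⟧) →
  {a b c d e : Fin n} → a ≢ b → a ≢ c → b ≢ c →
  d ≢ a → d ≢ b → d ≢ c → e ≢ a → e ≢ b → e ≢ c → d ≢ e →
  m * #true₃ (bar3 χ a b d) (bar3 χ a b e) (bar3 χ c d e) + 2 * bar2 χ a c ≡
  m * #true₃ (bar3 χ a c d) (bar3 χ a c e) (bar3 χ b d e) + 2 * bar2 χ a b
exchange χ {q} {m} pairSum≡ {a} {b} {c} {d} {e} a≢b a≢c b≢c d≢a d≢b d≢c e≢a e≢b e≢c d≢e =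
  +-cancelˡ-≡ (3 * q) _ _ (begin
    3 * q + (m * #true₃ (bar3 χ a b d) (bar3 χ a b e) (bar3 χ c d e) + 2 * bar2 χ a c)
      ≡⟨ spread q m ⟦ bar3 χ a b d ⟧ ⟦ bar3 χ a b e ⟧ ⟦ bar3 χ c d e ⟧ (2 * bar2 χ a c) ⟩
    (q + m * ⟦ bar3 χ a b d ⟧) + (q + m * ⟦ bar3 χ a b e ⟧) + (q + m * ⟦ bar3 χ c d e ⟧) + 2 * bar2 χ a c
      ≡⟨ cong (_+ 2 * bar2 χ a c) (cong₂ _+_ (cong₂ _+_ abd abe) cde) ⟨
    pairSum χ a b d + pairSum χ a b e + pairSum χ c d e + 2 * bar2 χ a c
      ≡⟨ regroup (bar2 χ a b) (bar2 χ a c) (bar2 χ a d) (bar2 χ a e) (bar2 χ b d)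
                 (bar2 χ b e) (bar2 χ c d) (bar2 χ c e) (bar2 χ d e) ⟩
    pairSum χ a c d + pairSum χ a c e + pairSum χ b d e + 2 * bar2 χ a b
      ≡⟨ cong (_+ 2 * bar2 χ a b) (cong₂ _+_ (cong₂ _+_ acd ace) bde) ⟩
    (q + m * ⟦ bar3 χ a c d ⟧) + (q + m * ⟦ bar3 χ a c e ⟧) + (q + m * ⟦ bar3 χ b d e ⟧) + 2 * bar2 χ a b
      ≡⟨ spread q m ⟦ bar3 χ a c d ⟧ ⟦ bar3 χ a c e ⟧ ⟦ bar3 χ b d e ⟧ (2 * bar2 χ a b) ⟨
    3 * q + (m * #true₃ (bar3 χ a c d) (bar3 χ a c e) (bar3 χ b d e) + 2 * bar2 χ a b)
      ∎)
  where
  abd : pairSum χ a b d ≡ q + m * ⟦ bar3 χ a b d ⟧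
  abd = pairSum≡ a≢b (≢-sym d≢a) (≢-sym d≢b)
  abe : pairSum χ a b e ≡ q + m * ⟦ bar3 χ a b e ⟧
  abe = pairSum≡ a≢b (≢-sym e≢a) (≢-sym e≢b)
  cde : pairSum χ c d e ≡ q + m * ⟦ bar3 χ c d e ⟧
  cde = pairSum≡ (≢-sym d≢c) (≢-sym e≢c) d≢e
  acd : pairSum χ a c d ≡ q + m * ⟦ bar3 χ a c d ⟧
  acd = pairSum≡ a≢c (≢-sym d≢a) (≢-sym d≢c)
  ace : pairSum χ a c e ≡ q + m * ⟦ bar3 χ a c e ⟧
  ace = pairSum≡ a≢c (≢-sym e≢a) (≢-sym e≢c)
  bde : pairSum χ b d e ≡ q + m * ⟦ bar3 χ b d e ⟧
  bde = pairSum≡ (≢-sym d≢b) (≢-sym e≢b) d≢e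
  spread : ∀ q m x y z g →
    3 * q + (m * (x + y + z) + g) ≡ (q + m * x) + (q + m * y) + (q + m * z) + g
  spread = solve-∀
  regroup : ∀ ab ac ad ae bd be cd ce de →
    (ab + ad + bd) + (ab + ae + be) + (cd + ce + de) + 2 * ac ≡
    (ac + ad + cd) + (ac + ae + ce) + (bd + be + de) + 2 * ab
  regroup = solve-∀

λ₂-exchange : {χ : Colouring n} → IsLambda2Equitable n χ →
  {a b c d e : Fin n} → a ≢ b → a ≢ c → b ≢ c →
  d ≢ a → d ≢ b → d ≢ c → e ≢ a → e ≢ b → e ≢ c → d ≢ e →
  0 < n ∸ 4 ×
  (n ∸ 4) * #true₃ (bar3 χ a b d) (bar3 χ a b e) (bar3 χ c d e) + 2 * bar2 χ a c ≡
  (n ∸ 4) * #true₃ (bar3 χ a c d) (bar3 χ a c e) (bar3 χ b d e) + 2 * bar2 χ a b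
λ₂-exchange {n} {χ} (_ , _ , _ , p₂₁ , _ , equitable , λ₂)
  a≢b a≢c b≢c d≢a d≢b d≢c e≢a e≢b e≢c d≢e =
  m<n⇒0<n∸m 4<n ,
  exchange χ {p₂₁} {n ∸ 4} (pairSum-equitable χ equitable (λ₂⇒p₁₁+3≡p₂₁+[n∸4] λ₂ (<⇒≤ 4<n)))
    a≢b a≢c b≢c d≢a d≢b d≢c e≢a e≢b e≢c d≢e
  where
  4<n : 4 < n
  4<n = distinct₅⇒4<n a≢b a≢c b≢c d≢a d≢b d≢c e≢a e≢b e≢c d≢e

more-on-left-≢ : {m L R g₁ g₂ : ℕ} → 0 < m → R < L → g₁ ≡ g₂ → m * L + 2 * g₁ ≢ m * R + 2 * g₂
more-on-left-≢ {m} 0<m R<L refl eq =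
  <-irrefl (sym (*-cancelˡ-≡ _ _ m {{>-nonZero 0<m}} (+-cancelʳ-≡ _ _ _ eq))) R<L

fewer-on-left-≢ : {m L R g₁ g₂ : ℕ} → L ≤ R → g₁ < g₂ → m * L + 2 * g₁ ≢ m * R + 2 * g₂
fewer-on-left-≢ {m} L≤R g₁<g₂ eq = <-irrefl eq (+-mono-≤-< (*-monoʳ-≤ m L≤R) (*-monoʳ-< 2 g₁<g₂))

part₁-weights : {abd abe cde acd ace bde : Bool} →
  abd ≡ true → abe ≡ true → acd ≡ false → ace ≡ false →
  #true₃ acd ace bde < #true₃ abd abe cde
part₁-weights {cde = cde} {bde = bde} refl refl refl refl = s≤s (⟦b⟧≤1+k bde ⟦ cde ⟧)

part₂-weights : {abd abe cde acd ace bde : Bool} →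
  ((acd ≡ true × abe ≡ false × abd ≡ false × ace ≡ false)
   ⊎ (abd ≡ false × abe ≡ true × acd ≡ true × ace ≡ true)
   ⊎ (acd ≡ true × ace ≡ true × abd ≡ false × abe ≡ false)) →
  #true₃ abd abe cde ≤ #true₃ acd ace bde
part₂-weights {cde = cde} {bde = bde} (inj₁ (refl , refl , refl , refl)) = ⟦b⟧≤1+k cde ⟦ bde ⟧
part₂-weights {cde = cde} {bde = bde} (inj₂ (inj₁ (refl , refl , refl , refl))) =
  s≤s (⟦b⟧≤1+k cde ⟦ bde ⟧)
part₂-weights {cde = cde} {bde = bde} (inj₂ (inj₂ (refl , refl , refl , refl))) =
  ⟦b⟧≤1+k cde (suc ⟦ bde ⟧)

mainTheorem8 : (n : ℕ) (χ : Colouring n) → IsLambda2Equitable n χ →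
    (a b c : Fin n) → a ≢ b → a ≢ c → b ≢ c → bar3 χ a b c ≡ true →
    (bar2 χ a b ≡ bar2 χ a c →
      ¬ (∃[ d ] ∃[ e ] (d ≢ a × d ≢ b × d ≢ c × e ≢ a × e ≢ b × e ≢ c × d ≢ e ×
          bar3 χ a b d ≡ true × bar3 χ a b e ≡ true ×
          bar3 χ a c d ≡ false × bar3 χ a c e ≡ false)))
    ×
    (bar2 χ a b > bar2 χ a c →
      ¬ (∃[ d ] ∃[ e ] (d ≢ a × d ≢ b × d ≢ c × e ≢ a × e ≢ b × e ≢ c × d ≢ e ×
          ((bar3 χ a c d ≡ true × bar3 χ a b e ≡ false × bar3 χ a b d ≡ false × bar3 χ a c e ≡ false)
          ⊎ (bar3 χ a b d ≡ false × bar3 χ a b e ≡ true × bar3 χ a c d ≡ true × bar3 χ a c e ≡ true)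
          ⊎ (bar3 χ a c d ≡ true × bar3 χ a c e ≡ true × bar3 χ a b d ≡ false × bar3 χ a b e ≡ false)))))
mainTheorem8 n χ λ₂-equitable a b c a≢b a≢c b≢c _ =
  (λ { ab≡ac (d , e , d≢a , d≢b , d≢c , e≢a , e≢b , e≢c , d≢e , abd , abe , acd , ace) →
       let (0<m , weights) = λ₂-exchange λ₂-equitable a≢b a≢c b≢c d≢a d≢b d≢c e≢a e≢b e≢c d≢e
       in more-on-left-≢ {n ∸ 4} 0<m (part₁-weights abd abe acd ace) (sym ab≡ac) weights }) ,
  (λ { ab>ac (d , e , d≢a , d≢b , d≢c , e≢a , e≢b , e≢c , d≢e , case) →
       let (_ , weights) = λ₂-exchange λ₂-equitable a≢b a≢c b≢c d≢a d≢b d≢c e≢a e≢b e≢c d≢e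
       in fewer-on-left-≢ {n ∸ 4} (part₂-weights case) ab>ac weights })
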